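{- Let $r\ge 8$ and $n\ge 3r-7$ be integers. Let $T_n(r)$ be the graph obtained from the vertex-disjoint union $K_{r-4}^*\cup W_{n-3r+12}$ by adding all edges between the two vertices $u_1,u_2$ of maximum degree of $W_{n-3r+12}$ and the $r-4$ vertices of the base of $K_{r-4}^*$. Then $T_n(r)$ with a rainbow edge-coloring (all edges distinct colors) is $C_r$-rainbow saturated.
   Context: All graphs are finite, simple and undirected. For $m\ge 3$, $W_m=K_2\vee\overline{K_{m-2}}$ is the graph consisting of two adjacent vertices both joined to every vertex of an independent set of size $m-2$. For $s\ge 3$, $K_s^*$ is the graph obtained from a complete graph $K_s$ (called the base) by adding, for each base vertex $v$, two new vertices $x_v,y_v$ and the edges $vx_v,vy_v,x_vy_v$ (so $K_s^*$ has $3s$ vertices). An edge-coloring is a function $E(G)\to\mathbb{N}$; a (sub)graph is rainbow if its edges have distinct colors. An edge-colored graph is $C_r$-rainbow saturated if it contains no rainbow cycle on $r$ vertices but adding any nonedge with any color creates a rainbow cycle on $r$ vertices. -}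

module Defs where

open import Data.Nat using (ℕ; zero; suc; _+_; _*_; _∸_; _≤_)
open import Data.Fin using (Fin; toℕ)
open import Data.Fin.Properties as FinP using ()
open import Data.Sum using (_⊎_; inj₁; inj₂)
open import Data.Sum.Properties using (≡-dec)
open import Data.Product using (_×_; _,_; Σ; ∃)
open import Data.Bool using (if_then_else_; _∧_; _∨_)
open import Data.Unit using (⊤)
open import Data.Empty using (⊥)
open import Relation.Nullary using (¬_; Dec)
open import Relation.Nullary.Decidable using (⌊_⌋)
open import Relation.Binary.PropositionalEquality using (_≡_; _≢_)
open import Relation.Binary.Definitions using (DecidableEquality)
open import Function.Definitions using (Injective)

-- A graph on a vertex type V is given by an adjacency relation Adj
-- (symmetric, irreflexive for the graphs below).  An edge-coloring is
-- col : V → V → ℕ, where only the values col u v for adjacent u v matter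
-- and col u v ≡ col v u is required (an edge {u,v} gets one color).

CycEdge : (r : ℕ) → Fin r → Fin r → Set
CycEdge r i j = (suc (toℕ i) ≡ toℕ j) ⊎ ((suc (toℕ i) ≡ r) × (toℕ j ≡ 0))

-- A rainbow cycle on r vertices: r distinct vertices f 0,…,f (r-1),
-- consecutive (cyclically) ones adjacent, and the r cycle edges have
-- pairwise distinct colors (each cycle edge is determined by its start i).
HasRainbowCycle : {V : Set} (r : ℕ) (Adj : V → V → Set) (col : V → V → ℕ) → Set
HasRainbowCycle {V} r Adj col =
  Σ (Fin r → V) λ f →
    Injective _≡_ _≡_ f
    × (∀ i j → CycEdge r i j → Adj (f i) (f j))
    × (∀ i j i' j' → CycEdge r i j → CycEdge r i' j'
         → col (f i) (f j) ≡ col (f i') (f j') → i ≡ i')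

AddAdj : {V : Set} (Adj : V → V → Set) (u v : V) → V → V → Set
AddAdj Adj u v x y = Adj x y ⊎ ((x ≡ u × y ≡ v) ⊎ (x ≡ v × y ≡ u))

AddCol : {V : Set} → DecidableEquality V → (col : V → V → ℕ) (u v : V) (k : ℕ) → V → V → ℕ
AddCol _≟_ col u v k x y =
  if (⌊ x ≟ u ⌋ ∧ ⌊ y ≟ v ⌋) ∨ (⌊ x ≟ v ⌋ ∧ ⌊ y ≟ u ⌋) then k else col x y

RainbowSaturated : {V : Set} → DecidableEquality V → (r : ℕ)
  (Adj : V → V → Set) (col : V → V → ℕ) → Set
RainbowSaturated {V} _≟_ r Adj col =
  ¬ HasRainbowCycle r Adj col
  × (∀ (u v : V) → u ≢ v → ¬ Adj u v → ∀ (k : ℕ)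
       → HasRainbowCycle r (AddAdj Adj u v) (AddCol _≟_ col u v k))

SymmetricColoring : {V : Set} (Adj : V → V → Set) (col : V → V → ℕ) → Set
SymmetricColoring Adj col = ∀ u v → Adj u v → col u v ≡ col v u

RainbowColoring : {V : Set} (Adj : V → V → Set) (col : V → V → ℕ) → Set
RainbowColoring Adj col = ∀ u v x y → Adj u v → Adj x y → col u v ≡ col x y
  → (u ≡ x × v ≡ y) ⊎ (u ≡ y × v ≡ x)

-- The graph T_n(r) = K_s^* ∪ W_m plus all edges hub–base,
-- with s = r - 4 and m = n - 3r + 12 (so W_m has m - 2 = l leaves).
--
-- Vertices: base vertices v_i, pendant-triangle vertices x_i, y_i (i < s),
-- the two hubs u_1,u_2 of W_m (its max-degree vertices), and l leaves.

TV : (s l : ℕ) → Set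
TV s l = (Fin s ⊎ (Fin s ⊎ Fin s)) ⊎ (Fin 2 ⊎ Fin l)

pattern base i = inj₁ (inj₁ i)
pattern px i   = inj₁ (inj₂ (inj₁ i))
pattern py i   = inj₁ (inj₂ (inj₂ i))
pattern hub a  = inj₂ (inj₁ a)
pattern leaf j = inj₂ (inj₂ j)

_≟TV_ : {s l : ℕ} → DecidableEquality (TV s l)
_≟TV_ = ≡-dec (≡-dec FinP._≟_ (≡-dec FinP._≟_ FinP._≟_)) (≡-dec FinP._≟_ FinP._≟_)

TAdj : (s l : ℕ) → TV s l → TV s l → Set
-- K_s^*: base clique, and triangles v_i x_i y_i
TAdj s l (base i) (base j) = i ≢ j
TAdj s l (base i) (px j)   = i ≡ j
TAdj s l (px i)   (base j) = i ≡ j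
TAdj s l (base i) (py j)   = i ≡ j
TAdj s l (py i)   (base j) = i ≡ j
TAdj s l (px i)   (py j)   = i ≡ j
TAdj s l (py i)   (px j)   = i ≡ j
-- W_m = K_2 ∨ complement(K_{m-2}): hubs adjacent, each hub adjacent to all leaves
TAdj s l (hub a)  (hub b)  = a ≢ b
TAdj s l (hub a)  (leaf j) = ⊤
TAdj s l (leaf j) (hub a)  = ⊤
-- added edges: hubs to all base vertices
TAdj s l (hub a)  (base i) = ⊤
TAdj s l (base i) (hub a)  = ⊤
TAdj s l _        _        = ⊥

-- T_n(r) with s = r - 4, l = m - 2 = n - 3r + 10
TnrV : (n r : ℕ) → Set
TnrV n r = TV (r ∸ 4) (n + 10 ∸ 3 * r)

TnrAdj : (n r : ℕ) → TnrV n r → TnrV n r → Set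
TnrAdj n r = TAdj (r ∸ 4) (n + 10 ∸ 3 * r)

{-# OPTIONS --safe #-}
-- Write s = r - 4 for the number of base vertices. A cycle of T_n(r) cannot enter a pendant
-- triangle (both cycle neighbours of x_v would have to be v and y_v, and then the cycle is the
-- triangle), and it meets at most one vertex of W of degree two (two of them, both adjacent to
-- exactly u₁ and u₂, would close a 4-cycle). So a cycle has at most s + 3 < r vertices: T_n(r)
-- has no r-cycle at all, rainbow or not.
--
-- For saturation, let uv be a non-edge and k a colour. As the colouring is rainbow, at most one
-- edge xy has colour k, so it suffices to find an r-cycle of T_n(r) + uv that avoids xy. Embed
-- T(4, 3) (four base vertices with their triangles, u₁, u₂ and three leaves) so that its image
-- contains u, v and the base vertices among x, y. A finite check provides, for each kind of
-- non-edge uv of T(4, 3), up to three 8-cycles of T(4, 3) + uv with no common edge other than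
-- uv; each starts and ends at a base vertex or hub. Lift one that avoids xy, and splice
-- the s − 4 base vertices outside the image between its last and first vertex: base vertices
-- and hubs form a clique, and the new edges miss xy. The result has s + 4 = r vertices.
module Submission where

open import Defs
open import Data.Nat using (ℕ; zero; suc; _+_; _*_; _∸_; _≤_; _<_; z≤n; s≤s)
import Data.Nat.Properties as ℕ
open import Data.Fin as Fin using (Fin; zero; suc; toℕ; fromℕ; inject₁; _↑ˡ_; _↑ʳ_)
import Data.Fin.Properties as Fin
open import Data.Fin.Relation.Unary.Top using (view; ‵fromℕ; ‵inject₁)
open import Data.Fin.Patterns using (0F; 1F; 2F; 3F)
open import Data.Sum as Sum using (_⊎_; inj₁; inj₂)
open import Data.Sum.Properties using (inj₁-injective; inj₂-injective)
open import Data.Product using (_×_; _,_; Σ; ∃; ∃₂; proj₁; proj₂)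
open import Data.Bool using (if_then_else_)
open import Data.Vec using (Vec; []; _∷_; lookup)
open import Data.Vec.Functional using (_++_)
open import Data.Vec.Functional.Properties using (lookup-++ˡ; lookup-++ʳ)
open import Data.List using (List; []; _∷_)
import Data.List.Relation.Unary.All as All
open import Data.List.Relation.Unary.All using (All)
import Data.List.Relation.Unary.Any as Any
open import Data.List.Relation.Unary.Any using (Any)
open import Data.Empty using (⊥; ⊥-elim)
open import Data.Unit using (⊤)
open import Function using (_∘_; id)
open import Function.Definitions using (Injective)
open import Relation.Nullary using (¬_; ¬?; Dec; yes; no; does; contradiction)
open import Relation.Nullary.Decidable
  using (True; toWitness; isYes≗does; dec-true; dec-false; map′; _×-dec_; _⊎-dec_; _→-dec_)
open import Relation.Binary.Definitions using (Symmetric; DecidableEquality)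
open import Relation.Binary.PropositionalEquality using (_≡_; _≢_; refl; sym; trans; cong; subst; subst₂)

SameEdge : {V : Set} → V → V → V → V → Set
SameEdge a b x y = (a ≡ x × b ≡ y) ⊎ (a ≡ y × b ≡ x)

module _ {V : Set} where

  SameEdge-sym : {a b x y : V} → SameEdge a b x y → SameEdge a b y x
  SameEdge-sym (inj₁ (p , q)) = inj₂ (p , q)
  SameEdge-sym (inj₂ (p , q)) = inj₁ (p , q)

  SameEdge-trans : {a b c d x y : V} → SameEdge a b x y → SameEdge c d x y → SameEdge a b c d
  SameEdge-trans (inj₁ (p , q)) (inj₁ (p′ , q′)) = inj₁ (trans p (sym p′) , trans q (sym q′))
  SameEdge-trans (inj₁ (p , q)) (inj₂ (p′ , q′)) = inj₂ (trans p (sym q′) , trans q (sym p′))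
  SameEdge-trans (inj₂ (p , q)) (inj₁ (p′ , q′)) = inj₂ (trans p (sym q′) , trans q (sym p′))
  SameEdge-trans (inj₂ (p , q)) (inj₂ (p′ , q′)) = inj₁ (trans p (sym p′) , trans q (sym q′))

  SameEdge-map : ∀ {W : Set} (h : V → W) {a b x y : V} → SameEdge a b x y → SameEdge (h a) (h b) (h x) (h y)
  SameEdge-map h (inj₁ (p , q)) = inj₁ (cong h p , cong h q)
  SameEdge-map h (inj₂ (p , q)) = inj₂ (cong h p , cong h q)

  SameEdge-reflect : ∀ {W : Set} {h : V → W} → Injective _≡_ _≡_ h
                     → {a b x y : V} → SameEdge (h a) (h b) (h x) (h y) → SameEdge a b x y
  SameEdge-reflect h-inj (inj₁ (p , q)) = inj₁ (h-inj p , h-inj q)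
  SameEdge-reflect h-inj (inj₂ (p , q)) = inj₂ (h-inj p , h-inj q)

  SameEdge? : DecidableEquality V → (a b x y : V) → Dec (SameEdge a b x y)
  SameEdge? _≟_ a b x y = ((a ≟ x) ×-dec (b ≟ y)) ⊎-dec ((a ≟ y) ×-dec (b ≟ x))

module _ {N : ℕ} where

  infixl 5 _▸_
  data Walk : ℕ → Fin N → Fin N → Set where
    []  : ∀ {i} → Walk 0 i i
    _▸_ : ∀ {k i j j′} → Walk k i j → CycEdge N j j′ → Walk (suc k) i j′

  walk-displacement : ∀ {k i j} → Walk k i j → k < N →
                      toℕ j ≡ toℕ i + k ⊎ toℕ j + N ≡ toℕ i + k
  walk-displacement {i = i} [] _ = inj₁ (sym (ℕ.+-identityʳ (toℕ i)))
  walk-displacement {suc k} {i} (w ▸ e) 1+k<N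
    with walk-displacement w (ℕ.<-trans (ℕ.n<1+n k) 1+k<N) | e
  ... | inj₁ d | inj₁ e = inj₁ (trans (sym e) (trans (cong suc d) (sym (ℕ.+-suc (toℕ i) k))))
  ... | inj₁ d | inj₂ (e , e₀) =
    inj₂ (trans (cong (_+ N) e₀) (trans (sym e) (trans (cong suc d) (sym (ℕ.+-suc (toℕ i) k)))))
  ... | inj₂ d | inj₁ e = inj₂ (trans (cong (_+ N) (sym e)) (trans (cong suc d) (sym (ℕ.+-suc (toℕ i) k))))
  -- a second wrap-around would take more than N steps
  walk-displacement {suc k} {i} (_▸_ {j = j} w _) 1+k<N | inj₂ d | inj₂ (e , _) =
    ⊥-elim (ℕ.<-irrefl (sym d) (subst (toℕ i + k <_) (ℕ.+-comm N (toℕ j))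
      (ℕ.+-mono-< (Fin.toℕ<n i) (ℕ.≤-pred (subst (suc (suc k) ≤_) (sym e) 1+k<N)))))

  no-closed-walk : ∀ {k i} → Walk k i i → 0 < k → k < N → ⊥
  no-closed-walk {k} {i} w 0<k k<N with walk-displacement w k<N
  ... | inj₁ d = ℕ.<-irrefl (sym (ℕ.+-cancelˡ-≡ (toℕ i) k 0 (trans (sym d) (sym (ℕ.+-identityʳ _))))) 0<k
  ... | inj₂ d = ℕ.<-irrefl (sym (ℕ.+-cancelˡ-≡ (toℕ i) N k d)) k<N

  CycEdge-injective : ∀ {i i′ j} → CycEdge N i j → CycEdge N i′ j → i ≡ i′
  CycEdge-injective (inj₁ e) (inj₁ e′) = Fin.toℕ-injective (ℕ.suc-injective (trans e (sym e′)))
  CycEdge-injective (inj₁ e) (inj₂ (_ , e₀)) with trans e e₀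
  ... | ()
  CycEdge-injective (inj₂ (_ , e₀)) (inj₁ e′) with trans e′ e₀
  ... | ()
  CycEdge-injective (inj₂ (e , _)) (inj₂ (e′ , _)) = Fin.toℕ-injective (ℕ.suc-injective (trans e (sym e′)))

  CycEdge-functional : ∀ {i j j′} → CycEdge N i j → CycEdge N i j′ → j ≡ j′
  CycEdge-functional (inj₁ e) (inj₁ e′) = Fin.toℕ-injective (trans (sym e) e′)
  CycEdge-functional {j = j} (inj₁ e) (inj₂ (e′ , _)) =
    ⊥-elim (ℕ.<-irrefl (trans (sym e) e′) (Fin.toℕ<n j))
  CycEdge-functional {j′ = j′} (inj₂ (e , _)) (inj₁ e′) =
    ⊥-elim (ℕ.<-irrefl (trans (sym e′) e) (Fin.toℕ<n j′))
  CycEdge-functional (inj₂ (_ , e₀)) (inj₂ (_ , e₀′)) = Fin.toℕ-injective (trans e₀ (sym e₀′))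

module _ {n : ℕ} where

  next : Fin (suc n) → Fin (suc n)
  next i with view i
  ... | ‵fromℕ = zero
  ... | ‵inject₁ j = suc j

  prev : Fin (suc n) → Fin (suc n)
  prev zero = fromℕ n
  prev (suc j) = inject₁ j

  CycEdge-next : ∀ i → CycEdge (suc n) i (next i)
  CycEdge-next i with view i
  ... | ‵fromℕ = inj₂ (cong suc (Fin.toℕ-fromℕ n) , refl)
  ... | ‵inject₁ j = inj₁ (cong suc (Fin.toℕ-inject₁ j))

  CycEdge-prev : ∀ j → CycEdge (suc n) (prev j) j
  CycEdge-prev zero = inj₂ (cong suc (Fin.toℕ-fromℕ n) , refl)
  CycEdge-prev (suc j) = inj₁ (cong suc (Fin.toℕ-inject₁ j))

  CycEdge⇒≡next : ∀ {i j} → CycEdge (suc n) i j → j ≡ next i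
  CycEdge⇒≡next e = CycEdge-functional e (CycEdge-next _)

data Position (m n : ℕ) : Fin (m + n) → Set where
  kept : (k : Fin m) → Position m n (k ↑ˡ n)
  inserted : (j : Fin n) → Position m n (m ↑ʳ j)

position : ∀ m {n} (i : Fin (m + n)) → Position m n i
position m {n} i = subst (Position m n) (Fin.join-splitAt m n i) (from-sum (Fin.splitAt m i))
  where
  from-sum : ∀ x → Position m n (Fin.join m n x)
  from-sum (inj₁ k) = kept k
  from-sum (inj₂ j) = inserted j

module _ {m n : ℕ} where

  CycEdge-kept-kept : ∀ {k k′} → CycEdge (m + n) (k ↑ˡ n) (k′ ↑ˡ n) → CycEdge m k k′
  CycEdge-kept-kept {k} {k′} (inj₁ e) =
    inj₁ (trans (cong suc (sym (Fin.toℕ-↑ˡ k n))) (trans e (Fin.toℕ-↑ˡ k′ n)))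
  CycEdge-kept-kept {k} {k′} (inj₂ (e , e₀)) =
    inj₂ ( ℕ.≤-antisym (Fin.toℕ<n k)
             (subst (m ≤_) (trans (sym e) (cong suc (Fin.toℕ-↑ˡ k n))) (ℕ.m≤m+n m n))
         , trans (sym (Fin.toℕ-↑ˡ k′ n)) e₀)

  CycEdge-kept-inserted : ∀ {k j} → CycEdge (m + n) (k ↑ˡ n) (m ↑ʳ j) → suc (toℕ k) ≡ m
  CycEdge-kept-inserted {k} {j} e = ℕ.≤-antisym (Fin.toℕ<n k) (m≤1+k e)
    where
    1+k≡ : ∀ {o} → suc (toℕ (k ↑ˡ n)) ≡ o → suc (toℕ k) ≡ o
    1+k≡ = trans (cong suc (sym (Fin.toℕ-↑ˡ k n)))
    m≤1+k : CycEdge (m + n) (k ↑ˡ n) (m ↑ʳ j) → m ≤ suc (toℕ k)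
    m≤1+k (inj₁ e) = subst (m ≤_) (sym (1+k≡ (trans e (Fin.toℕ-↑ʳ m j)))) (ℕ.m≤m+n m (toℕ j))
    m≤1+k (inj₂ (e , _)) = subst (m ≤_) (sym (1+k≡ e)) (ℕ.m≤m+n m n)

  CycEdge-inserted-kept : ∀ {j k} → CycEdge (m + n) (m ↑ʳ j) (k ↑ˡ n) → toℕ k ≡ 0
  CycEdge-inserted-kept {j} {k} (inj₁ e) = ⊥-elim (ℕ.<⇒≱ (Fin.toℕ<n k) (ℕ.<⇒≤ m<k))
    where
    m<k : m < toℕ k
    m<k = subst (m <_) (trans (cong suc (sym (Fin.toℕ-↑ʳ m j))) (trans e (Fin.toℕ-↑ˡ k n)))
                (s≤s (ℕ.m≤m+n m (toℕ j)))
  CycEdge-inserted-kept {k = k} (inj₂ (_ , e₀)) = trans (sym (Fin.toℕ-↑ˡ k n)) e₀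

-- Cycles of G + uv whose old edges are allowed

module _ {V : Set} (Adj : V → V → Set) (u v : V) where

  Usable : (Allowed : V → V → Set) → V → V → Set
  Usable Allowed a b = SameEdge a b u v ⊎ (Adj a b × Allowed a b)

  record AugmentedCycle (r : ℕ) (Allowed : V → V → Set) : Set where
    constructor augmented-cycle
    field
      vertex : Fin r → V
      injective : Injective _≡_ _≡_ vertex
      usable : ∀ i j → CycEdge r i j → Usable Allowed (vertex i) (vertex j)

  AugmentedCycle-mono : ∀ {r} {A B : V → V → Set} → (∀ {a b} → Adj a b → A a b → B a b)
                        → AugmentedCycle r A → AugmentedCycle r B
  AugmentedCycle-mono {A = A} {B} A⇒B (augmented-cycle f f-inj usable) =
    augmented-cycle f f-inj λ i j e → weaken (usable i j e)
    where
    weaken : ∀ {a b} → Usable A a b → Usable B a b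
    weaken (inj₁ new) = inj₁ new
    weaken (inj₂ (ab , allowed)) = inj₂ (ab , A⇒B ab allowed)

AugmentedCycle-swap : ∀ {V} (Adj : V → V → Set) (u v : V) {r A}
                      → AugmentedCycle Adj u v r A → AugmentedCycle Adj v u r A
AugmentedCycle-swap Adj u v {A = A} (augmented-cycle f f-inj usable) =
  augmented-cycle f f-inj λ i j e → swap (usable i j e)
  where
  swap : ∀ {a b} → Usable Adj u v A a b → Usable Adj v u A a b
  swap (inj₁ new) = inj₁ (SameEdge-sym new)
  swap (inj₂ old) = inj₂ old

module _ {V : Set} (_≟_ : DecidableEquality V) (col : V → V → ℕ) (u v : V) (k : ℕ) where

  private
    AddCol≡if : ∀ a b → AddCol _≟_ col u v k a b ≡ (if does (SameEdge? _≟_ a b u v) then k else col a b)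
    AddCol≡if a b
      rewrite isYes≗does (a ≟ u) | isYes≗does (b ≟ v) | isYes≗does (a ≟ v) | isYes≗does (b ≟ u) = refl

  AddCol-new : ∀ {a b} → SameEdge a b u v → AddCol _≟_ col u v k a b ≡ k
  AddCol-new {a} {b} new =
    trans (AddCol≡if a b) (cong (if_then k else col a b) (dec-true (SameEdge? _≟_ a b u v) new))

  AddCol-old : ∀ {a b} → ¬ SameEdge a b u v → AddCol _≟_ col u v k a b ≡ col a b
  AddCol-old {a} {b} old =
    trans (AddCol≡if a b) (cong (if_then k else col a b) (dec-false (SameEdge? _≟_ a b u v) old))

module _ {V : Set} (_≟_ : DecidableEquality V) {Adj : V → V → Set} (Adj-sym : Symmetric Adj)
         {col : V → V → ℕ} (rainbow : RainbowColoring Adj col) {u v : V} (u≁v : ¬ Adj u v) where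

  rainbow-augmented-cycle : ∀ {r k} → 3 ≤ r → AugmentedCycle Adj u v r (λ a b → col a b ≢ k)
                            → HasRainbowCycle r (AddAdj Adj u v) (AddCol _≟_ col u v k)
  rainbow-augmented-cycle {r} {k} 3≤r (augmented-cycle f f-inj usable) =
    f , f-inj , adjacent , distinct-colours
    where
    not-new : ∀ {a b} → Adj a b → ¬ SameEdge a b u v
    not-new ab (inj₁ (refl , refl)) = u≁v ab
    not-new ab (inj₂ (refl , refl)) = u≁v (Adj-sym ab)

    adjacent : ∀ i j → CycEdge r i j → AddAdj Adj u v (f i) (f j)
    adjacent i j e with usable i j e
    ... | inj₁ new = inj₂ new
    ... | inj₂ (ab , _) = inj₁ ab

    same-edge : ∀ {i j i′ j′} → CycEdge r i j → CycEdge r i′ j′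
                → SameEdge (f i) (f j) (f i′) (f j′) → i ≡ i′
    same-edge _ _ (inj₁ (p , _)) = f-inj p
    same-edge e e′ (inj₂ (p , q)) with f-inj p | f-inj q
    ... | refl | refl = ⊥-elim (no-closed-walk ([] ▸ e ▸ e′) (s≤s z≤n) 3≤r)

    colour : ∀ {a b} → Adj a b → AddCol _≟_ col u v k a b ≡ col a b
    colour ab = AddCol-old _≟_ col u v k (not-new ab)

    distinct-colours : ∀ i j i′ j′ → CycEdge r i j → CycEdge r i′ j′
      → AddCol _≟_ col u v k (f i) (f j) ≡ AddCol _≟_ col u v k (f i′) (f j′) → i ≡ i′
    distinct-colours i j i′ j′ e e′ eq with usable i j e | usable i′ j′ e′
    ... | inj₁ new | inj₁ new′ = same-edge e e′ (SameEdge-trans new new′)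
    ... | inj₁ new | inj₂ (ab′ , ≢k) =
      contradiction (trans (sym (colour ab′)) (trans (sym eq) (AddCol-new _≟_ col u v k new))) ≢k
    ... | inj₂ (ab , ≢k) | inj₁ new′ =
      contradiction (trans (sym (colour ab)) (trans eq (AddCol-new _≟_ col u v k new′))) ≢k
    ... | inj₂ (ab , _) | inj₂ (ab′ , _) =
      same-edge e e′ (rainbow _ _ _ _ ab ab′ (trans (sym (colour ab)) (trans eq (colour ab′))))

-- Vertices of degree two on a long cycle

module _ {V : Set} {Adj : V → V → Set} where

  NeighboursIn : V → V → V → Set
  NeighboursIn z a b = ∀ w → Adj z w → w ≡ a ⊎ w ≡ b

  module OnCycle (Adj-sym : Symmetric Adj) {n : ℕ} (f : Fin (suc n) → V) (f-inj : Injective _≡_ _≡_ f)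
                 (f-adj : ∀ i j → CycEdge (suc n) i j → Adj (f i) (f j)) where

    private
      closed : ∀ {k i j} → Walk k i j → f j ≡ f i → 0 < k → k < suc n → ⊥
      closed w fj≡fi with f-inj fj≡fi
      ... | refl = no-closed-walk w

    cycle-neighbours : ∀ {z a b p p⁻ p⁺} → 2 < suc n → NeighboursIn z a b
      → CycEdge (suc n) p⁻ p → CycEdge (suc n) p p⁺ → f p ≡ z → SameEdge (f p⁺) (f p⁻) a b
    cycle-neighbours {z} {p = p} {p⁻} {p⁺} 2<N nbrs e⁻ e⁺ refl
      with nbrs (f p⁺) (f-adj p p⁺ e⁺) | nbrs (f p⁻) (Adj-sym (f-adj p⁻ p e⁻))
    ... | inj₁ p⁺a | inj₂ p⁻b = inj₁ (p⁺a , p⁻b)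
    ... | inj₂ p⁺b | inj₁ p⁻a = inj₂ (p⁺b , p⁻a)
    ... | inj₁ p⁺a | inj₁ p⁻a = ⊥-elim (closed ([] ▸ e⁻ ▸ e⁺) (trans p⁺a (sym p⁻a)) (s≤s z≤n) 2<N)
    ... | inj₂ p⁺b | inj₂ p⁻b = ⊥-elim (closed ([] ▸ e⁻ ▸ e⁺) (trans p⁺b (sym p⁻b)) (s≤s z≤n) 2<N)

    -- Both cycle neighbours of z, and then of y, must lie in the triangle z y b.
    pendant-triangle : ∀ {z y b} p → 3 < suc n → z ≢ b → NeighboursIn z b y → NeighboursIn y b z
                       → f p ≢ z
    pendant-triangle {z} {y} {b} p 3<N z≢b z-nbrs y-nbrs fp =
      split (cycle-neighbours 2<N z-nbrs (CycEdge-prev p) (CycEdge-next p) fp)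
      where
      2<N : 2 < suc n
      2<N = ℕ.<-trans (ℕ.n<1+n 2) 3<N

      split : SameEdge (f (next p)) (f (prev p)) b y → ⊥
      split (inj₁ (p⁺b , p⁻y))
        with cycle-neighbours 2<N y-nbrs (CycEdge-prev (prev p)) (CycEdge-prev p) p⁻y
      ... | inj₁ (fp≡b , _) = z≢b (trans (sym fp) fp≡b)
      ... | inj₂ (_ , p⁻⁻b) =
        closed ([] ▸ CycEdge-prev (prev p) ▸ CycEdge-prev p ▸ CycEdge-next p)
               (trans p⁺b (sym p⁻⁻b)) (s≤s z≤n) 3<N
      split (inj₂ (p⁺y , p⁻b))
        with cycle-neighbours 2<N y-nbrs (CycEdge-next p) (CycEdge-next (next p)) p⁺y
      ... | inj₁ (p⁺⁺b , _) =
        closed ([] ▸ CycEdge-prev p ▸ CycEdge-next p ▸ CycEdge-next (next p))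
               (trans p⁺⁺b (sym p⁻b)) (s≤s z≤n) 3<N
      ... | inj₂ (_ , fp≡b) = z≢b (trans (sym fp) fp≡b)

    -- Two such vertices would close a 4-cycle through a and b.
    twins : ∀ {z z′ a b} p q → 4 < suc n → NeighboursIn z a b → NeighboursIn z′ a b
            → f p ≡ z → f q ≡ z′ → p ≡ q
    twins p q 4<N z-nbrs z′-nbrs fp fq =
      split (SameEdge-trans (cycle-neighbours 2<N z-nbrs (CycEdge-prev p) (CycEdge-next p) fp)
                            (cycle-neighbours 2<N z′-nbrs (CycEdge-prev q) (CycEdge-next q) fq))
      where
      2<N : 2 < suc n
      2<N = ℕ.<-trans (ℕ.n<1+n 2) (ℕ.<-trans (ℕ.n<1+n 3) 4<N)

      split : SameEdge (f (next p)) (f (prev p)) (f (next q)) (f (prev q)) → p ≡ q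
      split (inj₁ (p⁺≡q⁺ , _)) =
        CycEdge-injective (CycEdge-next p) (subst (CycEdge _ q) (sym (f-inj p⁺≡q⁺)) (CycEdge-next q))
      split (inj₂ (p⁺≡q⁻ , p⁻≡q⁺)) =
        ⊥-elim (closed ([] ▸ CycEdge-next p
                           ▸ subst (λ m → CycEdge _ m q) (sym (f-inj p⁺≡q⁻)) (CycEdge-prev q)
                           ▸ CycEdge-next q
                           ▸ subst (λ m → CycEdge _ m p) (f-inj p⁻≡q⁺) (CycEdge-prev p))
                       refl (s≤s z≤n) 4<N)

module _ {s l : ℕ} where

  TAdj-sym : Symmetric (TAdj s l)
  TAdj-sym {base i} {base j} i≢j = i≢j ∘ sym
  TAdj-sym {base i} {px j} i≡j = sym i≡j
  TAdj-sym {base i} {py j} i≡j = sym i≡j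
  TAdj-sym {base i} {hub a} _ = _
  TAdj-sym {px i} {base j} i≡j = sym i≡j
  TAdj-sym {px i} {py j} i≡j = sym i≡j
  TAdj-sym {py i} {base j} i≡j = sym i≡j
  TAdj-sym {py i} {px j} i≡j = sym i≡j
  TAdj-sym {hub a} {base j} _ = _
  TAdj-sym {hub a} {hub b} a≢b = a≢b ∘ sym
  TAdj-sym {hub a} {leaf w} _ = _
  TAdj-sym {leaf w} {hub a} _ = _

  TAdj? : (x y : TV s l) → Dec (TAdj s l x y)
  TAdj? (base i) (base j) = ¬? (i Fin.≟ j)
  TAdj? (base i) (px j) = i Fin.≟ j
  TAdj? (base i) (py j) = i Fin.≟ j
  TAdj? (base i) (hub a) = yes _
  TAdj? (base i) (leaf w) = no λ ()
  TAdj? (px i) (base j) = i Fin.≟ j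
  TAdj? (px i) (px j) = no λ ()
  TAdj? (px i) (py j) = i Fin.≟ j
  TAdj? (px i) (hub a) = no λ ()
  TAdj? (px i) (leaf w) = no λ ()
  TAdj? (py i) (base j) = i Fin.≟ j
  TAdj? (py i) (px j) = i Fin.≟ j
  TAdj? (py i) (py j) = no λ ()
  TAdj? (py i) (hub a) = no λ ()
  TAdj? (py i) (leaf w) = no λ ()
  TAdj? (hub a) (base j) = yes _
  TAdj? (hub a) (px j) = no λ ()
  TAdj? (hub a) (py j) = no λ ()
  TAdj? (hub a) (hub b) = ¬? (a Fin.≟ b)
  TAdj? (hub a) (leaf w) = yes _
  TAdj? (leaf w) (base j) = no λ ()
  TAdj? (leaf w) (px j) = no λ ()
  TAdj? (leaf w) (py j) = no λ ()
  TAdj? (leaf w) (hub a) = yes _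
  TAdj? (leaf w) (leaf w′) = no λ ()

  Junction : TV s l → Set
  Junction (base _) = ⊤
  Junction (hub _) = ⊤
  Junction _ = ⊥

  Junction? : (x : TV s l) → Dec (Junction x)
  Junction? (base _) = yes _
  Junction? (hub _) = yes _
  Junction? (px _) = no λ ()
  Junction? (py _) = no λ ()
  Junction? (leaf _) = no λ ()

  junctions-adjacent : ∀ {x y} → Junction x → Junction y → x ≢ y → TAdj s l x y
  junctions-adjacent {base i} {base j} _ _ x≢y = x≢y ∘ cong base
  junctions-adjacent {base i} {hub b} _ _ _ = _
  junctions-adjacent {hub a} {base j} _ _ _ = _
  junctions-adjacent {hub a} {hub b} _ _ x≢y = x≢y ∘ cong hub

  px-neighbours : ∀ i → NeighboursIn {Adj = TAdj s l} (px i) (base i) (py i)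
  px-neighbours i (base j) i≡j = inj₁ (cong base (sym i≡j))
  px-neighbours i (py j) i≡j = inj₂ (cong py (sym i≡j))

  py-neighbours : ∀ i → NeighboursIn {Adj = TAdj s l} (py i) (base i) (px i)
  py-neighbours i (base j) i≡j = inj₁ (cong base (sym i≡j))
  py-neighbours i (px j) i≡j = inj₂ (cong px (sym i≡j))

  leaf-neighbours : ∀ w → NeighboursIn {Adj = TAdj s l} (leaf w) (hub zero) (hub (suc zero))
  leaf-neighbours w (hub zero) _ = inj₁ refl
  leaf-neighbours w (hub (suc zero)) _ = inj₂ refl

  block : TV s l → Fin s ⊎ Fin 3
  block (base i) = inj₁ i
  block (px i) = inj₁ i
  block (py i) = inj₁ i
  block (hub a) = inj₂ (inject₁ a)
  block (leaf _) = inj₂ (fromℕ 2)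

  data NonPendant : TV s l → Set where
    base′ : ∀ i → NonPendant (base i)
    hub′ : ∀ a → NonPendant (hub a)
    leaf′ : ∀ w → NonPendant (leaf w)

  IsLeaf : TV s l → Set
  IsLeaf x = ∃ λ w → x ≡ leaf w

  block-injective : ∀ {x y} → NonPendant x → NonPendant y → block x ≡ block y
                    → x ≡ y ⊎ IsLeaf x × IsLeaf y
  block-injective (base′ i) (base′ j) refl = inj₁ refl
  block-injective (hub′ a) (hub′ b) eq = inj₁ (cong hub (Fin.inject₁-injective (inj₂-injective eq)))
  block-injective (hub′ a) (leaf′ w) eq = ⊥-elim (Fin.fromℕ≢inject₁ (sym (inj₂-injective eq)))
  block-injective (leaf′ w) (hub′ b) eq = ⊥-elim (Fin.fromℕ≢inject₁ (inj₂-injective eq))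
  block-injective (leaf′ w) (leaf′ w′) _ = inj₂ ((w , refl) , (w′ , refl))

-- A cycle of T(s, l) avoids the pendant triangles and meets at most one leaf.
circumference : ∀ {s l n} (f : Fin (suc n) → TV s l) → Injective _≡_ _≡_ f
  → (∀ i j → CycEdge (suc n) i j → TAdj s l (f i) (f j)) → 4 < suc n → suc n ≤ s + 3
circumference {s} {l} {n} f f-inj f-adj 4<N = Fin.injective⇒≤ block∘f-injective
  where
  open OnCycle {Adj = TAdj s l} TAdj-sym f f-inj f-adj

  3<N : 3 < suc n
  3<N = ℕ.<-trans (ℕ.n<1+n 3) 4<N

  non-pendant : ∀ p → NonPendant (f p)
  non-pendant p with f p in fp
  ... | base i = base′ i
  ... | hub a = hub′ a
  ... | leaf w = leaf′ w
  ... | px i = ⊥-elim (pendant-triangle p 3<N (λ ()) (px-neighbours i) (py-neighbours i) fp)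
  ... | py i = ⊥-elim (pendant-triangle p 3<N (λ ()) (py-neighbours i) (px-neighbours i) fp)

  join-injective : ∀ {x y} → Fin.join s 3 x ≡ Fin.join s 3 y → x ≡ y
  join-injective {x} {y} eq =
    trans (sym (Fin.splitAt-join s 3 x)) (trans (cong (Fin.splitAt s) eq) (Fin.splitAt-join s 3 y))

  block∘f-injective : Injective _≡_ _≡_ (Fin.join s 3 ∘ block ∘ f)
  block∘f-injective {p} {q} eq
    with block-injective (non-pendant p) (non-pendant q) (join-injective eq)
  ... | inj₁ fp≡fq = f-inj fp≡fq
  ... | inj₂ ((w , fp) , (w′ , fq)) = twins p q 4<N (leaf-neighbours w) (leaf-neighbours w′) fp fq

module _ {A B : Set} {P : A ⊎ B → Set} where

  any?-⊎ : Dec (∃ (P ∘ inj₁)) → Dec (∃ (P ∘ inj₂)) → Dec (∃ P)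
  any?-⊎ p q = map′ from to (p ⊎-dec q)
    where
    from : ∃ (P ∘ inj₁) ⊎ ∃ (P ∘ inj₂) → ∃ P
    from (inj₁ (a , pa)) = inj₁ a , pa
    from (inj₂ (b , pb)) = inj₂ b , pb
    to : ∃ P → ∃ (P ∘ inj₁) ⊎ ∃ (P ∘ inj₂)
    to (inj₁ a , pa) = inj₁ (a , pa)
    to (inj₂ b , pb) = inj₂ (b , pb)

  all?-⊎ : Dec (∀ a → P (inj₁ a)) → Dec (∀ b → P (inj₂ b)) → Dec (∀ x → P x)
  all?-⊎ p q = map′ (λ (f , g) → Sum.[ f , g ]) (λ h → h ∘ inj₁ , h ∘ inj₂) (p ×-dec q)

module _ {s l : ℕ} {P : TV s l → Set} (P? : ∀ x → Dec (P x)) where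

  any?-TV : Dec (∃ P)
  any?-TV = any?-⊎ (any?-⊎ (Fin.any? (P? ∘ base)) (any?-⊎ (Fin.any? (P? ∘ px)) (Fin.any? (P? ∘ py))))
                   (any?-⊎ (Fin.any? (P? ∘ hub)) (Fin.any? (P? ∘ leaf)))

  all?-TV : Dec (∀ x → P x)
  all?-TV = all?-⊎ (all?-⊎ (Fin.all? (P? ∘ base)) (all?-⊎ (Fin.all? (P? ∘ px)) (Fin.all? (P? ∘ py))))
                   (all?-⊎ (Fin.all? (P? ∘ hub)) (Fin.all? (P? ∘ leaf)))

complement : ∀ m {t} (a : Fin m → Fin (m + t)) → Injective _≡_ _≡_ a
  → Σ (Fin t → Fin (m + t)) λ c → Injective _≡_ _≡_ c × (∀ j k → c j ≢ a k)
complement zero a _ = id , id , λ _ ()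
complement (suc m) {t} a a-inj =
  let c , c-inj , c∉a′ = complement m a′ a′-inj in
  punchIn₀ ∘ c , c-inj ∘ Fin.punchIn-injective (a zero) _ _ , disjoint c c∉a′
  where
  punchIn₀ : Fin (m + t) → Fin (suc m + t)
  punchIn₀ = Fin.punchIn (a zero)

  a₀≢a₁₊ : ∀ k → a zero ≢ a (suc k)
  a₀≢a₁₊ k eq = Fin.0≢1+n (a-inj eq)

  a′ : Fin m → Fin (m + t)
  a′ k = Fin.punchOut (a₀≢a₁₊ k)

  a′-inj : Injective _≡_ _≡_ a′
  a′-inj eq = Fin.suc-injective (a-inj (Fin.punchOut-injective (a₀≢a₁₊ _) (a₀≢a₁₊ _) eq))

  disjoint : (c : Fin t → Fin (m + t)) → (∀ j k → c j ≢ a′ k) → ∀ j k → punchIn₀ (c j) ≢ a k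
  disjoint c _ j zero = Fin.punchInᵢ≢i (a zero) (c j)
  disjoint c c∉a′ j (suc k) eq =
    c∉a′ j k (Fin.punchIn-injective (a zero) _ _ (trans eq (sym (Fin.punchIn-punchOut _))))

module _ {A : Set} where

  ∷-injective : ∀ {m z} {as : Vec A m} → (∀ k → lookup as k ≢ z) → Injective _≡_ _≡_ (lookup as)
                → Injective _≡_ _≡_ (lookup (z ∷ as))
  ∷-injective z∉ _ {zero} {zero} _ = refl
  ∷-injective z∉ _ {zero} {suc k} eq = ⊥-elim (z∉ k (sym eq))
  ∷-injective z∉ _ {suc j} {zero} eq = ⊥-elim (z∉ j eq)
  ∷-injective _ as-inj {suc j} {suc k} eq = cong suc (as-inj eq)

  []-injective : Injective _≡_ _≡_ (lookup {A = A} [])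
  []-injective {()}

  distinct₁ : (i : A) → Injective _≡_ _≡_ (lookup (i ∷ []))
  distinct₁ _ = ∷-injective (λ ()) []-injective

  distinct₂ : {i j : A} → i ≢ j → Injective _≡_ _≡_ (lookup (i ∷ j ∷ []))
  distinct₂ {i} {j} i≢j = ∷-injective j≢i (distinct₁ j)
    where
    j≢i : ∀ k → lookup (j ∷ []) k ≢ i
    j≢i zero = i≢j ∘ sym

module _ {m t : ℕ} (as : Vec (Fin (m + suc t)) m) (as-inj : Injective _≡_ _≡_ (lookup as)) where

  extend : Σ (Fin (m + suc t)) λ z → Injective _≡_ _≡_ (lookup (z ∷ as))
  extend =
    let c , _ , c∉as = complement m (lookup as) as-inj in
    c zero , ∷-injective (λ k eq → c∉as zero k (sym eq)) as-inj

  extend-covering : (x : Fin (m + suc t))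
    → Σ (Fin (m + suc t)) λ z → Injective _≡_ _≡_ (lookup (z ∷ as))
                              × ∃ λ k → lookup (z ∷ as) k ≡ x
  extend-covering x with Fin.any? (λ k → lookup as k Fin.≟ x)
  ... | yes (k , eq) = proj₁ extend , proj₂ extend , suc k , eq
  ... | no x∉as = x , ∷-injective (λ k eq → x∉as (k , eq)) as-inj , zero , refl

⊎-map-injective : ∀ {A B C D : Set} {f : A → C} {g : B → D}
                  → Injective _≡_ _≡_ f → Injective _≡_ _≡_ g → Injective _≡_ _≡_ (Sum.map f g)
⊎-map-injective f-inj _ {inj₁ _} {inj₁ _} eq = cong inj₁ (f-inj (inj₁-injective eq))
⊎-map-injective _ g-inj {inj₂ _} {inj₂ _} eq = cong inj₂ (g-inj (inj₂-injective eq))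
⊎-map-injective _ _ {inj₁ _} {inj₂ _} ()
⊎-map-injective _ _ {inj₂ _} {inj₁ _} ()

module _ {s l s′ l′ : ℕ} (a : Fin s → Fin s′) (b : Fin l → Fin l′) where

  embed : TV s l → TV s′ l′
  embed (base i) = base (a i)
  embed (px i) = px (a i)
  embed (py i) = py (a i)
  embed (hub h) = hub h
  embed (leaf w) = leaf (b w)

  embed-injective : Injective _≡_ _≡_ a → Injective _≡_ _≡_ b → Injective _≡_ _≡_ embed
  embed-injective a-inj b-inj {x} {y} eq =
    ⊎-map-injective (⊎-map-injective a-inj (⊎-map-injective a-inj a-inj)) (⊎-map-injective id b-inj)
      (trans (sym (embed-as-map x)) (trans eq (embed-as-map y)))
    where
    embed-as-map : ∀ z → embed z ≡ Sum.map (Sum.map a (Sum.map a a)) (Sum.map id b) z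
    embed-as-map (base _) = refl
    embed-as-map (px _) = refl
    embed-as-map (py _) = refl
    embed-as-map (hub _) = refl
    embed-as-map (leaf _) = refl

  embed-adjacent : Injective _≡_ _≡_ a → ∀ {x y} → TAdj s l x y → TAdj s′ l′ (embed x) (embed y)
  embed-adjacent a-inj {base i} {base j} i≢j = i≢j ∘ a-inj
  embed-adjacent _ {base i} {px j} i≡j = cong a i≡j
  embed-adjacent _ {base i} {py j} i≡j = cong a i≡j
  embed-adjacent _ {base i} {hub h} _ = _
  embed-adjacent _ {px i} {base j} i≡j = cong a i≡j
  embed-adjacent _ {px i} {py j} i≡j = cong a i≡j
  embed-adjacent _ {py i} {base j} i≡j = cong a i≡j
  embed-adjacent _ {py i} {px j} i≡j = cong a i≡j
  embed-adjacent _ {hub h} {base j} _ = _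
  embed-adjacent _ {hub h} {hub h′} h≢h′ = h≢h′
  embed-adjacent _ {hub h} {leaf w} _ = _
  embed-adjacent _ {leaf w} {hub h} _ = _

-- Eight-cycles of T(4, 3)

T₄₃ : Set
T₄₃ = TV 4 3

-- The base vertices of a larger T(s, l) missing from a copy of T(4, 3)
-- are inserted between the last and the first vertex of the cycle.
record Template (u v : T₄₃) (Allowed : T₄₃ → T₄₃ → Set) : Set where
  field
    eight-cycle : AugmentedCycle (TAdj 4 3) u v 8 Allowed
    last-junction : Junction (AugmentedCycle.vertex eight-cycle (fromℕ 7))
    first-junction : Junction (AugmentedCycle.vertex eight-cycle zero)

Table : T₄₃ → T₄₃ → Set
Table u v = ∀ x y → Template u v (λ a b → ¬ SameEdge a b x y)

module Candidates (u v : T₄₃) where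

  Valid : Vec T₄₃ 8 → Set
  Valid c = (∀ i j → lookup c i ≡ lookup c j → i ≡ j)
          × (∀ k → SameEdge (lookup c k) (lookup c (next k)) u v ⊎ TAdj 4 3 (lookup c k) (lookup c (next k)))
          × Junction (lookup c (fromℕ 7)) × Junction (lookup c zero)

  Avoids : T₄₃ → T₄₃ → Vec T₄₃ 8 → Set
  Avoids x y c = ∀ k → SameEdge (lookup c k) (lookup c (next k)) u v
                       ⊎ ¬ SameEdge (lookup c k) (lookup c (next k)) x y

  Covering : List (Vec T₄₃ 8) → Set
  Covering cs = All Valid cs × (∀ x y → Any (Avoids x y) cs)

  covering? : (cs : List (Vec T₄₃ 8)) → Dec (Covering cs)
  covering? cs = All.all? valid? cs ×-dec all?-TV (λ x → all?-TV (λ y → Any.any? (avoids? x y) cs))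
    where
    _≟_ : DecidableEquality T₄₃
    _≟_ = _≟TV_

    new? : ∀ a b → Dec (SameEdge a b u v)
    new? a b = SameEdge? _≟_ a b u v

    valid? : ∀ c → Dec (Valid c)
    valid? c = Fin.all? (λ i → Fin.all? (λ j → (lookup c i ≟ lookup c j) →-dec (i Fin.≟ j)))
      ×-dec Fin.all? (λ k → new? (lookup c k) (lookup c (next k)) ⊎-dec TAdj? (lookup c k) (lookup c (next k)))
      ×-dec Junction? (lookup c (fromℕ 7)) ×-dec Junction? (lookup c zero)

    avoids? : ∀ x y c → Dec (Avoids x y c)
    avoids? x y c = Fin.all? (λ k → new? (lookup c k) (lookup c (next k))
                                    ⊎-dec ¬? (SameEdge? _≟_ (lookup c k) (lookup c (next k)) x y))

  template : ∀ {x y c} → Valid c → Avoids x y c → Template u v (λ a b → ¬ SameEdge a b x y)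
  template {x} {y} {c} (distinct , edges , last , first) avoids = record
    { eight-cycle = augmented-cycle (lookup c) (λ {i} {j} → distinct i j) usable
    ; last-junction = last
    ; first-junction = first
    }
    where
    usable : ∀ i j → CycEdge 8 i j
             → Usable (TAdj 4 3) u v (λ a b → ¬ SameEdge a b x y) (lookup c i) (lookup c j)
    usable i j e rewrite CycEdge⇒≡next e with edges i | avoids i
    ... | inj₁ new | _ = inj₁ new
    ... | inj₂ _ | inj₁ new = inj₁ new
    ... | inj₂ adj | inj₂ allowed = inj₂ (adj , allowed)

  table : (cs : List (Vec T₄₃ 8)) → True (covering? cs) → Table u v
  table cs ok x y =
    let all-valid , some-avoid = toWitness ok
        valid , avoids = All.lookupAny all-valid (some-avoid x y)
    in template {c = Any.lookup (some-avoid x y)} valid avoids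

open Candidates using (table)

-- The endpoints of the new edge use the last base and leaf indices;
-- an embedding is free to choose the images of the others.

table-X-B : Table (px 2F) (base 3F)
table-X-B = table _ _
  ( (base 2F ∷ px 2F ∷ base 3F ∷ base 0F ∷ base 1F ∷ hub 0F ∷ leaf 0F ∷ hub 1F ∷ [])
  ∷ (base 3F ∷ px 2F ∷ py 2F ∷ base 2F ∷ base 0F ∷ hub 0F ∷ hub 1F ∷ base 1F ∷ [])
  ∷ []) _

table-Y-B : Table (py 2F) (base 3F)
table-Y-B = table _ _
  ( (base 2F ∷ py 2F ∷ base 3F ∷ base 0F ∷ base 1F ∷ hub 0F ∷ leaf 0F ∷ hub 1F ∷ [])
  ∷ (base 3F ∷ py 2F ∷ px 2F ∷ base 2F ∷ base 0F ∷ hub 0F ∷ hub 1F ∷ base 1F ∷ [])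
  ∷ []) _

table-B-L : Table (base 3F) (leaf 2F)
table-B-L = table _ _
  ( (base 3F ∷ leaf 2F ∷ hub 0F ∷ leaf 0F ∷ hub 1F ∷ base 0F ∷ base 1F ∷ base 2F ∷ [])
  ∷ (base 3F ∷ leaf 2F ∷ hub 0F ∷ leaf 0F ∷ hub 1F ∷ base 0F ∷ base 2F ∷ base 1F ∷ [])
  ∷ (base 3F ∷ leaf 2F ∷ hub 1F ∷ leaf 1F ∷ hub 0F ∷ base 1F ∷ base 0F ∷ base 2F ∷ [])
  ∷ []) _

table-X-H : ∀ h → Table (px 3F) (hub h)
table-X-H 0F = table _ _
  ( (base 3F ∷ px 3F ∷ hub 0F ∷ leaf 0F ∷ hub 1F ∷ base 0F ∷ base 1F ∷ base 2F ∷ [])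
  ∷ (hub 0F ∷ px 3F ∷ py 3F ∷ base 3F ∷ base 0F ∷ base 2F ∷ hub 1F ∷ base 1F ∷ [])
  ∷ []) _
table-X-H 1F = table _ _
  ( (base 3F ∷ px 3F ∷ hub 1F ∷ leaf 0F ∷ hub 0F ∷ base 0F ∷ base 1F ∷ base 2F ∷ [])
  ∷ (hub 1F ∷ px 3F ∷ py 3F ∷ base 3F ∷ base 0F ∷ base 2F ∷ hub 0F ∷ base 1F ∷ [])
  ∷ []) _

table-Y-H : ∀ h → Table (py 3F) (hub h)
table-Y-H 0F = table _ _
  ( (base 3F ∷ py 3F ∷ hub 0F ∷ leaf 0F ∷ hub 1F ∷ base 0F ∷ base 1F ∷ base 2F ∷ [])
  ∷ (hub 0F ∷ py 3F ∷ px 3F ∷ base 3F ∷ base 0F ∷ base 2F ∷ hub 1F ∷ base 1F ∷ [])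
  ∷ []) _
table-Y-H 1F = table _ _
  ( (base 3F ∷ py 3F ∷ hub 1F ∷ leaf 0F ∷ hub 0F ∷ base 0F ∷ base 1F ∷ base 2F ∷ [])
  ∷ (hub 1F ∷ py 3F ∷ px 3F ∷ base 3F ∷ base 0F ∷ base 2F ∷ hub 0F ∷ base 1F ∷ [])
  ∷ []) _

table-X-X : Table (px 2F) (px 3F)
table-X-X = table _ _
  ( (base 2F ∷ px 2F ∷ px 3F ∷ base 3F ∷ base 0F ∷ base 1F ∷ hub 0F ∷ hub 1F ∷ [])
  ∷ (base 2F ∷ py 2F ∷ px 2F ∷ px 3F ∷ py 3F ∷ base 3F ∷ hub 0F ∷ base 0F ∷ [])
  ∷ []) _

table-X-Y : Table (px 2F) (py 3F)
table-X-Y = table _ _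
  ( (base 2F ∷ px 2F ∷ py 3F ∷ base 3F ∷ base 0F ∷ base 1F ∷ hub 0F ∷ hub 1F ∷ [])
  ∷ (base 2F ∷ py 2F ∷ px 2F ∷ py 3F ∷ px 3F ∷ base 3F ∷ hub 0F ∷ base 0F ∷ [])
  ∷ []) _

table-Y-Y : Table (py 2F) (py 3F)
table-Y-Y = table _ _
  ( (base 2F ∷ py 2F ∷ py 3F ∷ base 3F ∷ base 0F ∷ base 1F ∷ hub 0F ∷ hub 1F ∷ [])
  ∷ (base 2F ∷ px 2F ∷ py 2F ∷ py 3F ∷ px 3F ∷ base 3F ∷ hub 0F ∷ base 0F ∷ [])
  ∷ []) _

table-X-L : Table (px 3F) (leaf 2F)
table-X-L = table _ _
  ( (base 3F ∷ px 3F ∷ leaf 2F ∷ hub 0F ∷ base 0F ∷ base 1F ∷ base 2F ∷ hub 1F ∷ [])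
  ∷ (base 3F ∷ py 3F ∷ px 3F ∷ leaf 2F ∷ hub 1F ∷ base 0F ∷ base 2F ∷ hub 0F ∷ [])
  ∷ []) _

table-Y-L : Table (py 3F) (leaf 2F)
table-Y-L = table _ _
  ( (base 3F ∷ py 3F ∷ leaf 2F ∷ hub 0F ∷ base 0F ∷ base 1F ∷ base 2F ∷ hub 1F ∷ [])
  ∷ (base 3F ∷ px 3F ∷ py 3F ∷ leaf 2F ∷ hub 1F ∷ base 0F ∷ base 2F ∷ hub 0F ∷ [])
  ∷ []) _

table-L-L : Table (leaf 1F) (leaf 2F)
table-L-L = table _ _
  ( (hub 0F ∷ leaf 1F ∷ leaf 2F ∷ hub 1F ∷ base 0F ∷ base 1F ∷ base 2F ∷ base 3F ∷ [])
  ∷ (hub 1F ∷ leaf 1F ∷ leaf 2F ∷ hub 0F ∷ base 1F ∷ base 3F ∷ base 0F ∷ base 2F ∷ [])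
  ∷ []) _

-- Lifting eight-cycles of T(4, 3) to (8 + t)-cycles of T(4 + t, l)

Covers : ∀ {s l m} → Vec (Fin s) m → TV s l → Set
Covers a x = ∀ {i} → x ≡ base i → ∃ λ k → lookup a k ≡ i

module Lift {t l : ℕ} (a : Vec (Fin (4 + t)) 4) (a-inj : Injective _≡_ _≡_ (lookup a))
            (b : Vec (Fin l) 3) (b-inj : Injective _≡_ _≡_ (lookup b)) where

  V : Set
  V = TV (4 + t) l

  E : T₄₃ → V
  E = embed (lookup a) (lookup b)

  E-injective : Injective _≡_ _≡_ E
  E-injective = embed-injective (lookup a) (lookup b) a-inj b-inj

  E-junction : ∀ {z} → Junction z → Junction (E z)
  E-junction {base _} _ = _
  E-junction {hub _} _ = _

  rest : Fin t → Fin (4 + t)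
  rest = proj₁ (complement 4 (lookup a) a-inj)

  rest-injective : Injective _≡_ _≡_ rest
  rest-injective = proj₁ (proj₂ (complement 4 (lookup a) a-inj))

  rest∉a : ∀ j k → rest j ≢ lookup a k
  rest∉a = proj₂ (proj₂ (complement 4 (lookup a) a-inj))

  E≢rest : ∀ z j → E z ≢ base (rest j)
  E≢rest (base i) j eq = rest∉a j i (sym (inj₁-injective (inj₁-injective eq)))
  E≢rest (px _) _ ()
  E≢rest (py _) _ ()
  E≢rest (hub _) _ ()
  E≢rest (leaf _) _ ()

  rest-uncovered : ∀ {x : V} → Covers a x → ∀ j → base (rest j) ≢ x
  rest-uncovered x-cov j eq with x-cov (sym eq)
  ... | k , ak≡rest = rest∉a j k (sym ak≡rest)

  module _ {u v : T₄₃} {A : T₄₃ → T₄₃ → Set} {x y : V} (template : Template u v A)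
           (transfer : ∀ {p q} → A p q → ¬ SameEdge (E p) (E q) x y)
           (x-cov : Covers a x) (y-cov : Covers a y) where

    open Template template
    open AugmentedCycle eight-cycle renaming (vertex to g; injective to g-inj; usable to g-usable)

    F : Fin (8 + t) → V
    F = (E ∘ g) ++ (base ∘ rest)

    F-kept : ∀ k → F (k ↑ˡ t) ≡ E (g k)
    F-kept = lookup-++ˡ (E ∘ g) (base ∘ rest)

    F-inserted : ∀ j → F (8 ↑ʳ j) ≡ base (rest j)
    F-inserted = lookup-++ʳ (E ∘ g) (base ∘ rest)

    F-injective : Injective _≡_ _≡_ F
    F-injective {i} {i′} eq with position 8 i | position 8 i′
    ... | kept k | kept k′ = cong (_↑ˡ t) (g-inj (E-injective (trans (sym (F-kept k)) (trans eq (F-kept k′)))))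
    ... | kept k | inserted j = ⊥-elim (E≢rest _ j (trans (sym (F-kept k)) (trans eq (F-inserted j))))
    ... | inserted j | kept k = ⊥-elim (E≢rest _ j (trans (sym (F-kept k)) (trans (sym eq) (F-inserted j))))
    ... | inserted j | inserted j′ = cong (8 ↑ʳ_) (rest-injective (inj₁-injective (inj₁-injective
                                       (trans (sym (F-inserted j)) (trans eq (F-inserted j′))))))

    Allowed : V → V → Set
    Allowed p q = ¬ SameEdge p q x y

    lift-usable : ∀ {p q} → Usable (TAdj 4 3) u v A p q → Usable (TAdj (4 + t) l) (E u) (E v) Allowed (E p) (E q)
    lift-usable (inj₁ new) = inj₁ (SameEdge-map E new)
    lift-usable (inj₂ (pq , allowed)) = inj₂ (embed-adjacent (lookup a) (lookup b) a-inj pq , transfer allowed)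

    Outside : V → Set
    Outside z = z ≢ x × z ≢ y

    F-inserted-outside : ∀ j → Outside (F (8 ↑ʳ j))
    F-inserted-outside j = (λ eq → rest-uncovered x-cov j (trans (sym (F-inserted j)) eq))
                         , (λ eq → rest-uncovered y-cov j (trans (sym (F-inserted j)) eq))

    F-inserted-junction : ∀ j → Junction (F (8 ↑ʳ j))
    F-inserted-junction j = subst Junction (sym (F-inserted j)) _

    F-kept-junction : ∀ {k} → Junction (g k) → Junction (F (k ↑ˡ t))
    F-kept-junction {k} = subst Junction (sym (F-kept k)) ∘ E-junction

    bridge : ∀ {i i′} → CycEdge (8 + t) i i′ → Junction (F i) → Junction (F i′)
             → Outside (F i) ⊎ Outside (F i′) → Usable (TAdj (4 + t) l) (E u) (E v) Allowed (F i) (F i′)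
    bridge {i} {i′} e ji ji′ outside = inj₂ (junctions-adjacent ji ji′ distinct , avoids outside)
      where
      distinct : F i ≢ F i′
      distinct eq =
        no-closed-walk ([] ▸ subst (CycEdge _ i) (sym (F-injective eq)) e) (s≤s z≤n) (s≤s (s≤s z≤n))

      avoids : Outside (F i) ⊎ Outside (F i′) → Allowed (F i) (F i′)
      avoids (inj₁ (≢x , _)) (inj₁ (≡x , _)) = ≢x ≡x
      avoids (inj₁ (_ , ≢y)) (inj₂ (≡y , _)) = ≢y ≡y
      avoids (inj₂ (_ , ≢y)) (inj₁ (_ , ≡y)) = ≢y ≡y
      avoids (inj₂ (≢x , _)) (inj₂ (_ , ≡x)) = ≢x ≡x

    F-usable : ∀ i i′ → CycEdge (8 + t) i i′ → Usable (TAdj (4 + t) l) (E u) (E v) Allowed (F i) (F i′)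
    F-usable i i′ e with position 8 i | position 8 i′
    ... | kept k | kept k′ =
      subst₂ (Usable (TAdj (4 + t) l) (E u) (E v) Allowed) (sym (F-kept k)) (sym (F-kept k′))
             (lift-usable (g-usable k k′ (CycEdge-kept-kept e)))
    ... | kept k | inserted j =
      bridge e (F-kept-junction (subst (Junction ∘ g) 7≡k last-junction)) (F-inserted-junction j)
             (inj₂ (F-inserted-outside j))
      where
      7≡k : fromℕ 7 ≡ k
      7≡k = Fin.toℕ-injective (ℕ.suc-injective (sym (CycEdge-kept-inserted e)))
    ... | inserted j | kept k =
      bridge e (F-inserted-junction j) (F-kept-junction (subst (Junction ∘ g) 0≡k first-junction))
             (inj₁ (F-inserted-outside j))
      where
      0≡k : zero ≡ k
      0≡k = Fin.toℕ-injective (sym (CycEdge-inserted-kept e))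
    ... | inserted j | inserted j′ =
      bridge e (F-inserted-junction j) (F-inserted-junction j′) (inj₁ (F-inserted-outside j))

    lift-template : AugmentedCycle (TAdj (4 + t) l) (E u) (E v) (8 + t) Allowed
    lift-template = augmented-cycle F F-injective F-usable

  preimages : ∀ {p q x y} → SameEdge (E p) (E q) x y
              → (∃ λ x′ → E x′ ≡ x) × (∃ λ y′ → E y′ ≡ y)
  preimages {p} {q} (inj₁ (p≡x , q≡y)) = (p , p≡x) , (q , q≡y)
  preimages {p} {q} (inj₂ (p≡y , q≡x)) = (q , q≡x) , (p , p≡y)

  -- If x or y lies outside the copy, no lifted edge can be xy.
  lift : ∀ {u v x y} → Table u v → Covers a x → Covers a y
         → AugmentedCycle (TAdj (4 + t) l) (E u) (E v) (8 + t) (λ p q → ¬ SameEdge p q x y)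
  lift {u} {v} {x} {y} table x-cov y-cov
    with any?-TV (λ x′ → E x′ ≟TV x) | any?-TV (λ y′ → E y′ ≟TV y)
  ... | yes (x′ , refl) | yes (y′ , refl) =
    lift-template (table x′ y′) (λ ¬same same → ¬same (SameEdge-reflect E-injective same)) x-cov y-cov
  ... | no x∉E | _ = lift-template (table u v) (λ _ same → x∉E (proj₁ (preimages same))) x-cov y-cov
  ... | yes _ | no y∉E = lift-template (table u v) (λ _ same → y∉E (proj₂ (preimages same))) x-cov y-cov

module _ {t l : ℕ} where

  cover : (a₀ : Vec (Fin (4 + t)) 2) → Injective _≡_ _≡_ (lookup a₀) → (x y : TV (4 + t) l)
    → Σ (Fin (4 + t) × Fin (4 + t)) λ (z , z′) → let a = z ∷ z′ ∷ a₀ in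
        Injective _≡_ _≡_ (lookup a) × Covers a x × Covers a y
  cover a₀ a₀-inj x y =
    let z′ , a₁-inj , k₁ , a₁k₁≡ = extend-covering a₀ a₀-inj (base-index x)
        z , a-inj , k₂ , ak₂≡ = extend-covering (z′ ∷ a₀) a₁-inj (base-index y)
    in (z , z′) , a-inj , (λ x≡ → suc k₁ , trans a₁k₁≡ (cong base-index x≡))
                        , (λ y≡ → k₂ , trans ak₂≡ (cong base-index y≡))
    where
    base-index : TV (4 + t) l → Fin (4 + t)
    base-index (base i) = i
    base-index _ = zero

  -- z and z′ are the base indices that cover will choose for the forbidden edge.
  record Placement (u v : TV (4 + t) l) : Set where
    field
      {u′ v′} : T₄₃
      cycles : Table u′ v′
      pinned : Vec (Fin (4 + t)) 2
      pinned-injective : Injective _≡_ _≡_ (lookup pinned)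
      leaves : Vec (Fin l) 3
      leaves-injective : Injective _≡_ _≡_ (lookup leaves)
      u-image : ∀ {z z′} → embed (lookup (z ∷ z′ ∷ pinned)) (lookup leaves) u′ ≡ u
      v-image : ∀ {z z′} → embed (lookup (z ∷ z′ ∷ pinned)) (lookup leaves) v′ ≡ v

  placed-cycle : ∀ {u v} → Placement u v → ∀ x y
    → AugmentedCycle (TAdj (4 + t) l) u v (8 + t) (λ p q → ¬ SameEdge p q x y)
  placed-cycle placement x y =
    let (z , z′) , a-inj , x-covered , y-covered = cover pinned pinned-injective x y in
    subst₂ (λ u v → AugmentedCycle (TAdj (4 + t) l) u v (8 + t) (λ p q → ¬ SameEdge p q x y)) u-image v-image
      (Lift.lift (z ∷ z′ ∷ pinned) a-inj leaves leaves-injective cycles x-covered y-covered)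
    where
    open Placement placement

module _ {t l′ : ℕ} where

  private
    V : Set
    V = TV (4 + t) (3 + l′)

    Image : T₄₃ → Vec (Fin (4 + t)) 2 → Vec (Fin (3 + l′)) 3 → V → Set
    Image u′ pinned leaves u = ∀ {z z′} → embed (lookup (z ∷ z′ ∷ pinned)) (lookup leaves) u′ ≡ u

    some-leaves : Vec (Fin (3 + l′)) 3
    some-leaves = 0F ∷ 1F ∷ 2F ∷ []

    some-leaves-injective : Injective _≡_ _≡_ (lookup some-leaves)
    some-leaves-injective = ∷-injective 0∉ (distinct₂ (λ ()))
      where
      0∉ : ∀ k → lookup (1F ∷ 2F ∷ []) k ≢ 0F
      0∉ 0F ()
      0∉ 1F ()

    pinned-with : Fin (4 + t) → Vec (Fin (4 + t)) 2
    pinned-with i = proj₁ (extend (i ∷ []) (distinct₁ i)) ∷ i ∷ []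

    pinned-with-injective : ∀ i → Injective _≡_ _≡_ (lookup (pinned-with i))
    pinned-with-injective i = proj₂ (extend (i ∷ []) (distinct₁ i))

    leaves-with : Fin (3 + l′) → Vec (Fin (3 + l′)) 3
    leaves-with w =
      let w₁ , w₁∷w-inj = extend (w ∷ []) (distinct₁ w) in
      proj₁ (extend (w₁ ∷ w ∷ []) w₁∷w-inj) ∷ w₁ ∷ w ∷ []

    leaves-with-injective : ∀ w → Injective _≡_ _≡_ (lookup (leaves-with w))
    leaves-with-injective w = proj₂ (extend _ (proj₂ (extend (w ∷ []) (distinct₁ w))))

    leaves-with₂ : ∀ {w w′ : Fin (3 + l′)} → w ≢ w′ → Vec (Fin (3 + l′)) 3
    leaves-with₂ {w} {w′} w≢w′ = proj₁ (extend (w ∷ w′ ∷ []) (distinct₂ w≢w′)) ∷ w ∷ w′ ∷ []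

    leaves-with₂-injective : ∀ {w w′ : Fin (3 + l′)} (w≢w′ : w ≢ w′)
                             → Injective _≡_ _≡_ (lookup (leaves-with₂ w≢w′))
    leaves-with₂-injective w≢w′ = proj₂ (extend _ (distinct₂ w≢w′))

  at-two-triangles : ∀ {u v u′ v′} {i j : Fin (4 + t)} → i ≢ j → Table u′ v′
    → Image u′ (i ∷ j ∷ []) some-leaves u → Image v′ (i ∷ j ∷ []) some-leaves v → Placement u v
  at-two-triangles i≢j cycles u-image v-image = record
    { cycles = cycles ; pinned = _ ∷ _ ∷ [] ; pinned-injective = distinct₂ i≢j
    ; leaves = some-leaves ; leaves-injective = some-leaves-injective
    ; u-image = u-image ; v-image = v-image }

  at-triangle-and-hub : ∀ {u v u′ v′} (i : Fin (4 + t)) → Table u′ v′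
    → Image u′ (pinned-with i) some-leaves u → Image v′ (pinned-with i) some-leaves v → Placement u v
  at-triangle-and-hub i cycles u-image v-image = record
    { cycles = cycles ; pinned = pinned-with i ; pinned-injective = pinned-with-injective i
    ; leaves = some-leaves ; leaves-injective = some-leaves-injective
    ; u-image = u-image ; v-image = v-image }

  at-triangle-and-leaf : ∀ {u v u′ v′} (i : Fin (4 + t)) (w : Fin (3 + l′)) → Table u′ v′
    → Image u′ (pinned-with i) (leaves-with w) u → Image v′ (pinned-with i) (leaves-with w) v → Placement u v
  at-triangle-and-leaf i w cycles u-image v-image = record
    { cycles = cycles ; pinned = pinned-with i ; pinned-injective = pinned-with-injective i
    ; leaves = leaves-with w ; leaves-injective = leaves-with-injective w
    ; u-image = u-image ; v-image = v-image }

  at-two-leaves : ∀ {u v u′ v′} {w w′ : Fin (3 + l′)} (w≢w′ : w ≢ w′) → Table u′ v′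
    → Image u′ (0F ∷ 1F ∷ []) (leaves-with₂ w≢w′) u → Image v′ (0F ∷ 1F ∷ []) (leaves-with₂ w≢w′) v
    → Placement u v
  at-two-leaves w≢w′ cycles u-image v-image = record
    { cycles = cycles ; pinned = 0F ∷ 1F ∷ [] ; pinned-injective = distinct₂ (λ ())
    ; leaves = leaves-with₂ w≢w′ ; leaves-injective = leaves-with₂-injective w≢w′
    ; u-image = u-image ; v-image = v-image }

  placement : (u v : V) → u ≢ v → ¬ TAdj _ _ u v → Placement u v ⊎ Placement v u
  placement (base i) (base j) u≢v u≁v = ⊥-elim (u≁v (u≢v ∘ cong base))
  placement (base i) (px j) _ i≢j = inj₂ (at-two-triangles (i≢j ∘ sym) table-X-B refl refl)
  placement (base i) (py j) _ i≢j = inj₂ (at-two-triangles (i≢j ∘ sym) table-Y-B refl refl)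
  placement (base i) (hub h) _ u≁v = ⊥-elim (u≁v _)
  placement (base i) (leaf w) _ _ = inj₁ (at-triangle-and-leaf i w table-B-L refl refl)
  placement (px i) (base j) _ i≢j = inj₁ (at-two-triangles i≢j table-X-B refl refl)
  placement (px i) (px j) u≢v _ = inj₁ (at-two-triangles (u≢v ∘ cong px) table-X-X refl refl)
  placement (px i) (py j) _ i≢j = inj₁ (at-two-triangles i≢j table-X-Y refl refl)
  placement (px i) (hub h) _ _ = inj₁ (at-triangle-and-hub i (table-X-H h) refl refl)
  placement (px i) (leaf w) _ _ = inj₁ (at-triangle-and-leaf i w table-X-L refl refl)
  placement (py i) (base j) _ i≢j = inj₁ (at-two-triangles i≢j table-Y-B refl refl)
  placement (py i) (px j) _ i≢j = inj₂ (at-two-triangles (i≢j ∘ sym) table-X-Y refl refl)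
  placement (py i) (py j) u≢v _ = inj₁ (at-two-triangles (u≢v ∘ cong py) table-Y-Y refl refl)
  placement (py i) (hub h) _ _ = inj₁ (at-triangle-and-hub i (table-Y-H h) refl refl)
  placement (py i) (leaf w) _ _ = inj₁ (at-triangle-and-leaf i w table-Y-L refl refl)
  placement (hub h) (base j) _ u≁v = ⊥-elim (u≁v _)
  placement (hub h) (px j) _ _ = inj₂ (at-triangle-and-hub j (table-X-H h) refl refl)
  placement (hub h) (py j) _ _ = inj₂ (at-triangle-and-hub j (table-Y-H h) refl refl)
  placement (hub h) (hub h′) u≢v u≁v = ⊥-elim (u≁v (u≢v ∘ cong hub))
  placement (hub h) (leaf w) _ u≁v = ⊥-elim (u≁v _)
  placement (leaf w) (base j) _ _ = inj₂ (at-triangle-and-leaf j w table-B-L refl refl)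
  placement (leaf w) (px j) _ _ = inj₂ (at-triangle-and-leaf j w table-X-L refl refl)
  placement (leaf w) (py j) _ _ = inj₂ (at-triangle-and-leaf j w table-Y-L refl refl)
  placement (leaf w) (hub h) _ u≁v = ⊥-elim (u≁v _)
  placement (leaf w) (leaf w′) u≢v _ = inj₁ (at-two-leaves (u≢v ∘ cong leaf) table-L-L refl refl)

  cycle-avoiding : ∀ u v → u ≢ v → ¬ TAdj _ _ u v → ∀ x y
    → AugmentedCycle (TAdj (4 + t) (3 + l′)) u v (8 + t) (λ p q → ¬ SameEdge p q x y)
  cycle-avoiding u v u≢v u≁v x y with placement u v u≢v u≁v
  ... | inj₁ p = placed-cycle p x y
  ... | inj₂ p = AugmentedCycle-swap _ v u (placed-cycle p x y)

T-rainbow-saturated : ∀ {t l′} (col : TV (4 + t) (3 + l′) → TV (4 + t) (3 + l′) → ℕ)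
  → RainbowColoring (TAdj (4 + t) (3 + l′)) col → RainbowSaturated _≟TV_ (8 + t) (TAdj (4 + t) (3 + l′)) col
T-rainbow-saturated {t} {l′} col rainbow = no-rainbow-cycle , saturated
  where
  no-rainbow-cycle : ¬ HasRainbowCycle (8 + t) (TAdj (4 + t) (3 + l′)) col
  no-rainbow-cycle (f , f-inj , f-adj , _) =
    ℕ.1+n≰n (subst (8 + t ≤_) (ℕ.+-comm (4 + t) 3)
                   (circumference f f-inj f-adj (s≤s (s≤s (s≤s (s≤s (s≤s z≤n)))))))

  saturated : ∀ u v → u ≢ v → ¬ TAdj (4 + t) (3 + l′) u v → ∀ k
    → HasRainbowCycle (8 + t) (AddAdj (TAdj (4 + t) (3 + l′)) u v) (AddCol _≟TV_ col u v k)
  saturated u v u≢v u≁v k =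
    rainbow-augmented-cycle _≟TV_ TAdj-sym rainbow u≁v (s≤s (s≤s (s≤s z≤n)))
      (avoiding-colour (any?-TV (λ x → any?-TV (λ y → TAdj? x y ×-dec (col x y ℕ.≟ k)))))
    where
    avoiding-colour : Dec (∃₂ λ x y → TAdj (4 + t) (3 + l′) x y × col x y ≡ k)
      → AugmentedCycle (TAdj (4 + t) (3 + l′)) u v (8 + t) (λ a b → col a b ≢ k)
    avoiding-colour (yes (x , y , xy , coloured)) =
      AugmentedCycle-mono (TAdj (4 + t) (3 + l′)) u v
        (λ ab ¬same c≡k → ¬same (rainbow _ _ _ _ ab xy (trans c≡k (sym coloured))))
        (cycle-avoiding u v u≢v u≁v x y)
    avoiding-colour (no uncoloured) =
      AugmentedCycle-mono (TAdj (4 + t) (3 + l′)) u v (λ ab _ c≡k → uncoloured (_ , _ , ab , c≡k))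
        (cycle-avoiding u v u≢v u≁v u v)

leaves≥3 : ∀ r n → 3 * r ∸ 7 ≤ n → 3 ≤ n + 10 ∸ 3 * r
leaves≥3 r n 3r∸7≤n = ℕ.m+n≤o⇒m≤o∸n 3 (begin
  3 + 3 * r    ≤⟨ ℕ.+-monoʳ-≤ 3 (ℕ.≤-trans (ℕ.m≤n+m∸n (3 * r) 7) (ℕ.+-monoʳ-≤ 7 3r∸7≤n)) ⟩
  3 + (7 + n)  ≡⟨ ℕ.+-comm 10 n ⟩
  n + 10       ∎)
  where open ℕ.≤-Reasoning

proposition6p4 : ∀ (r n : ℕ) → 8 ≤ r → 3 * r ∸ 7 ≤ n
    → (col : TnrV n r → TnrV n r → ℕ)
    → SymmetricColoring (TnrAdj n r) col
    → RainbowColoring (TnrAdj n r) col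
    → RainbowSaturated _≟TV_ r (TnrAdj n r) col
proposition6p4 r n 8≤r 3r∸7≤n col _ rainbow = saturated 8≤r (leaves≥3 r n 3r∸7≤n) col rainbow
  where
  saturated : ∀ {r l} → 8 ≤ r → 3 ≤ l → (col : TV (r ∸ 4) l → TV (r ∸ 4) l → ℕ)
    → RainbowColoring (TAdj (r ∸ 4) l) col → RainbowSaturated _≟TV_ r (TAdj (r ∸ 4) l) col
  saturated (s≤s (s≤s (s≤s (s≤s (s≤s (s≤s (s≤s (s≤s z≤n))))))))
            (s≤s (s≤s (s≤s z≤n))) = T-rainbow-saturated
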